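{- Let $r$ be a positive integer and let $\tau:\{1,\dots,r\}\to\{1,\dots,r\}^+$ be the substitution $i\mapsto i(i+1)\cdots r\,1\,2\cdots(i-1)$ (so $1\mapsto12\cdots r$, $2\mapsto23\cdots r1$, $\dots$, $r\mapsto r12\cdots(r-1)$). For $1\le i\le r$ let $x^{(i)}$ be the fixed point of $\tau$ beginning with the letter $i$, and let $X\subseteq\{1,\dots,r\}^{\mathbb N}$ be the one-sided minimal subshift generated by $\tau$ (the shift orbit closure of $x^{(1)}$). Then each $x^{(i)}$ is distal in $X$. In particular, each of the two fixed points of the Thue–Morse substitution is distal.
   Context: Two words $x,y\in X$ are proximal if for every $N>0$ there exists $n\in\mathbb N$ with $x_nx_{n+1}\cdots x_{n+N}=y_ny_{n+1}\cdots y_{n+N}$. A point $x\in X$ is distal if the only point of $X$ proximal to $x$ is $x$ itself. The Thue–Morse substitution is the case $r=2$: $1\mapsto12$, $2\mapsto21$. -}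

module Defs where

open import Data.Nat using (ℕ; zero; suc; _+_; _<_; _≤_)
open import Data.Nat.DivMod using (_/_; _%_; m%n<n)
open import Data.Fin using (Fin; toℕ; fromℕ<)
open import Data.Vec using (Vec; lookup; tabulate)
open import Data.Product using (∃; _×_)
open import Relation.Binary.PropositionalEquality using (_≡_)

-- Alphabet {1,…,r} with r = suc m is represented by Fin (suc m);
-- the letter k ∈ {1,…,r} is represented by the Fin element k-1.

Seq : ℕ → Set
Seq m = ℕ → Fin (suc m)

modr : (m : ℕ) → ℕ → Fin (suc m)
modr m n = fromℕ< (m%n<n n (suc m))

-- The substitution τ : i ↦ i (i+1) ⋯ r 1 2 ⋯ (i-1), a word of length r:
-- its j-th letter (0-based) is i + j (mod r).
τ : (m : ℕ) → Fin (suc m) → Vec (Fin (suc m)) (suc m)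
τ m i = tabulate (λ j → modr m (toℕ i + toℕ j))

-- τ extended to infinite words (τ has constant length r):
-- τ(x) = τ(x₀) τ(x₁) τ(x₂) ⋯, so its n-th letter is the (n mod r)-th
-- letter of τ(x_{⌊n/r⌋}).
τ∞ : (m : ℕ) → Seq m → Seq m
τ∞ m x n = lookup (τ m (x (n / suc m))) (modr m n)

IsFixedPoint : (m : ℕ) → Seq m → Set
IsFixedPoint m x = ∀ n → τ∞ m x n ≡ x n

-- y lies in the shift-orbit closure of x (product topology): every finite
-- prefix of y occurs in x at some position.
InOrbitClosure : (m : ℕ) → Seq m → Seq m → Set
InOrbitClosure m x y = ∀ N → ∃ λ n → ∀ k → k < N → y k ≡ x (n + k)

Proximal : (m : ℕ) → Seq m → Seq m → Set
Proximal m x y = ∀ N → 0 < N → ∃ λ n → ∀ k → k ≤ N → x (n + k) ≡ y (n + k)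

Distal : (m : ℕ) → (Seq m → Set) → Seq m → Set
Distal m X x = X x × (∀ y → X y → Proximal m x y → ∀ k → y k ≡ x k)

-- Writing letters as 0, …, r-1, the fixed point starting with 0 is x₁(n) = s(n) mod r, where s(n)
-- is the base-r digit sum of n, and every other fixed point is x₁ + i.  If a point y of the
-- orbit closure agrees with x₁ + i on a long window [n, n + L], and that window (together with
-- the prefix of y) occurs in x₁ at position p, then s(p + u) ≡ s(u) + i (mod r) for all u in the
-- window.  This forces r ∣ p: otherwise the carries of p + u and of u occur at different places,
-- and one finds two consecutive q with s(q + 1) ≡ s(q), which is impossible since only one
-- of any two consecutive numbers can end in the digit r-1.  Dividing by r and iterating on
-- longer windows gives r^t ∣ p, hence y(t) = x₁(Q r^t + t) ≡ s(Q) + s(t) ≡ y(0) + s(t).  So y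
-- is determined by y(0), and proximality to x₁ + i forces y(0) = i.
module Submission where

open import Defs
open import Data.Empty using (⊥; ⊥-elim)
open import Data.Fin using (Fin; zero; toℕ)
open import Data.Fin.Properties using (toℕ-fromℕ<; toℕ-injective; toℕ<n)
open import Data.Nat
  using (ℕ; zero; suc; _+_; _*_; _∸_; _^_; _≤_; _<_; z≤n; s≤s; s≤s⁻¹; z<s; _/_; _%_; NonZero; >-nonZero⁻¹)
open import Data.Nat.DivMod
open import Data.Nat.Divisibility using (_∣_; divides; divides-refl; m%n≡0⇒n∣m; n∣m*n; 1∣_)
open import Data.Nat.Induction using (<-rec)
open import Data.Nat.Properties
open import Data.Nat.Tactic.RingSolver using (solve-∀)
open import Data.Product using (_,_)
open import Data.Sum using (inj₁; inj₂)
open import Data.Vec.Properties using (lookup∘tabulate)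
open import Function using (_∘_)
open import Relation.Binary.Bundles using (Setoid)
open import Relation.Binary.Structures using (IsEquivalence)
open import Relation.Binary.PropositionalEquality
  using (_≡_; refl; sym; trans; cong; cong₂; subst; subst₂; module ≡-Reasoning)
import Relation.Binary.Reasoning.Setoid as SetoidReasoning
open import Relation.Nullary using (¬_; yes; no)

+-rightComm : ∀ a b c → a + b + c ≡ a + c + b
+-rightComm = solve-∀

module Congruence (m : ℕ) where

  r : ℕ
  r = suc m

  infix 4 _≈_
  record _≈_ (a b : ℕ) : Set where
    constructor mod-eq
    field %-eq : a % r ≡ b % r

  open _≈_ public

  ≈-isEquivalence : IsEquivalence _≈_
  ≈-isEquivalence = record
    { refl  = mod-eq refl
    ; sym   = λ (mod-eq e) → mod-eq (sym e)
    ; trans = λ (mod-eq e) (mod-eq f) → mod-eq (trans e f)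
    }

  ≈-setoid : Setoid _ _
  ≈-setoid = record { isEquivalence = ≈-isEquivalence }

  open IsEquivalence ≈-isEquivalence public
    using () renaming (sym to ≈-sym; trans to ≈-trans)

  ≡⇒≈ : ∀ {a b} → a ≡ b → a ≈ b
  ≡⇒≈ refl = mod-eq refl

  %-≈ : ∀ a → a % r ≈ a
  %-≈ a = mod-eq (m%n%n≡m%n a r)

  +-cong : ∀ {a b c d} → a ≈ b → c ≈ d → a + c ≈ b + d
  +-cong {a} {b} {c} {d} (mod-eq e) (mod-eq f) = mod-eq (begin
    (a + c) % r          ≡⟨ %-distribˡ-+ a c r ⟩
    (a % r + c % r) % r  ≡⟨ cong₂ (λ u v → (u + v) % r) e f ⟩
    (b % r + d % r) % r  ≡⟨ %-distribˡ-+ b d r ⟨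
    (b + d) % r          ∎)
    where open ≡-Reasoning

  +-congˡ : ∀ a {b c} → b ≈ c → a + b ≈ a + c
  +-congˡ a = +-cong (mod-eq refl)

  +-congʳ : ∀ {a b} c → a ≈ b → a + c ≈ b + c
  +-congʳ c e = +-cong e (mod-eq refl)

  n+r≈n : ∀ n → n + r ≈ n
  n+r≈n n = mod-eq ([m+n]%n≡m%n n r)

  +-cancelʳ : ∀ {a b} c → a + c ≈ b + c → a ≈ b
  +-cancelʳ {a} {b} zero    e = subst₂ _≈_ (+-identityʳ a) (+-identityʳ b) e
  +-cancelʳ {a} {b} (suc c) e = +-cancelʳ c (begin
    a + c          ≈⟨ n+r≈n (a + c) ⟨
    a + c + r      ≡⟨ +-suc-shift a ⟩
    a + suc c + m  ≈⟨ +-congʳ m e ⟩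
    b + suc c + m  ≡⟨ +-suc-shift b ⟨
    b + c + r      ≈⟨ n+r≈n (b + c) ⟩
    b + c          ∎)
    where
    open SetoidReasoning ≈-setoid
    +-suc-shift : ∀ x → x + c + suc m ≡ x + suc c + m
    +-suc-shift x = trans (+-suc (x + c) m) (cong (_+ m) (sym (+-suc x c)))

  +-cancelˡ : ∀ c {a b} → c + a ≈ c + b → a ≈ b
  +-cancelˡ c {a} {b} e = +-cancelʳ c (subst₂ _≈_ (+-comm c a) (+-comm c b) e)

  +-*r-digits : ∀ n w → n + w * r ≡ n % r + (n / r + w) * r
  +-*r-digits n w = trans (cong (_+ w * r) (m≡m%n+[m/n]*n n r)) (collect (n % r) (n / r) w r)
    where
    collect : ∀ d q w r → d + q * r + w * r ≡ d + (q + w) * r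
    collect = solve-∀

  fill-last-digit : ∀ A k → A + (m ∸ A % r) + k * r ≡ m + (A / r + k) * r
  fill-last-digit A k = begin
    A + (m ∸ a) + k * r          ≡⟨ cong (λ t → t + (m ∸ a) + k * r) (m≡m%n+[m/n]*n A r) ⟩
    a + q * r + (m ∸ a) + k * r  ≡⟨ collect a q (m ∸ a) k r ⟩
    a + (m ∸ a) + (q + k) * r    ≡⟨ cong (_+ (q + k) * r) (m+[n∸m]≡n (s≤s⁻¹ (m%n<n A r))) ⟩
    m + (q + k) * r              ∎
    where
    open ≡-Reasoning
    a = A % r
    q = A / r
    collect : ∀ a q v k r → a + q * r + v + k * r ≡ a + v + (q + k) * r
    collect = solve-∀

  ≈0⇒r∣ : ∀ {a} → a ≈ 0 → r ∣ a
  ≈0⇒r∣ {a} (mod-eq e) = m%n≡0⇒n∣m a r e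

  toℕ-≈⇒≡ : ∀ {i j : Fin r} → toℕ i ≈ toℕ j → i ≡ j
  toℕ-≈⇒≡ {i} {j} (mod-eq e) =
    toℕ-injective (trans (sym (m<n⇒m%n≡m (toℕ<n i))) (trans e (m<n⇒m%n≡m (toℕ<n j))))

module DigitRecursion (m : ℕ) where

  open Congruence m public
  open SetoidReasoning ≈-setoid

  DigitRecursive : (ℕ → ℕ) → Set
  DigitRecursive f = ∀ n → f n ≈ f (n / r) + n % r

  [d+qr]%r≡d : ∀ {d} q → d < r → (d + q * r) % r ≡ d
  [d+qr]%r≡d {d} q d<r = trans ([m+kn]%n≡m%n d q r) (m<n⇒m%n≡m d<r)

  [d+qr]/r≡q : ∀ {d} q → d < r → (d + q * r) / r ≡ q
  [d+qr]/r≡q {d} q d<r =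
    trans (+-distrib-/-∣ʳ d (n∣m*n q)) (cong₂ _+_ (m<n⇒m/n≡0 d<r) (m*n/n≡m q r))

  digitRecursive-digit : ∀ {f} → DigitRecursive f → ∀ {d} q → d < r → f (d + q * r) ≈ f q + d
  digitRecursive-digit {f} f-rec {d} q d<r = begin
    f (d + q * r)                          ≈⟨ f-rec (d + q * r) ⟩
    f ((d + q * r) / r) + (d + q * r) % r  ≡⟨ cong₂ (λ a b → f a + b) ([d+qr]/r≡q q d<r) ([d+qr]%r≡d q d<r) ⟩
    f q + d                                ∎

  toℕ-modr : ∀ n → toℕ (modr m n) ≡ n % r
  toℕ-modr n = toℕ-fromℕ< (m%n<n n r)

  fixedPoint⇒digitRecursive : ∀ {x} → IsFixedPoint m x → DigitRecursive (toℕ ∘ x)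
  fixedPoint⇒digitRecursive {x} fixed n = begin
    toℕ (x n)                                        ≡⟨ cong toℕ (fixed n) ⟨
    toℕ (τ∞ m x n)                                   ≡⟨ cong toℕ (lookup∘tabulate (λ j → modr m (toℕ (x (n / r)) + toℕ j)) (modr m n)) ⟩
    toℕ (modr m (toℕ (x (n / r)) + toℕ (modr m n)))  ≡⟨ toℕ-modr (toℕ (x (n / r)) + toℕ (modr m n)) ⟩
    (toℕ (x (n / r)) + toℕ (modr m n)) % r           ≡⟨ cong (λ k → (toℕ (x (n / r)) + k) % r) (toℕ-modr n) ⟩
    (toℕ (x (n / r)) + n % r) % r                    ≈⟨ %-≈ _ ⟩
    toℕ (x (n / r)) + n % r                          ∎

-- s is the base-r digit sum, known only modulo r.
module DigitSum (m : ℕ) .{{_ : NonZero m}} (s : ℕ → ℕ)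
                (s-rec : DigitRecursion.DigitRecursive m s) (s-0 : s 0 ≡ 0) where

  open DigitRecursion m public
  open SetoidReasoning ≈-setoid

  1<r : 1 < r
  1<r = s≤s (>-nonZero⁻¹ m)

  1≉0 : ¬ 1 ≈ 0
  1≉0 (mod-eq 1%r≡0) with trans (sym (m<n⇒m%n≡m 1<r)) 1%r≡0
  ... | ()

  n<r^n : ∀ n → n < r ^ n
  n<r^n zero    = z<s
  n<r^n (suc n) = ≤-trans (+-mono-≤ (m^n>0 r n) (n<r^n n))
    (≤-trans (≤-reflexive (cong (r ^ n +_) (sym (+-identityʳ (r ^ n))))) (*-monoˡ-≤ (r ^ n) 1<r))

  s-digit : ∀ {d} q → d < r → s (d + q * r) ≈ s q + d
  s-digit = digitRecursive-digit s-rec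

  s-letter : ∀ {d} → d < r → s d ≈ d
  s-letter {d} d<r = begin
    s d            ≡⟨ cong s (+-identityʳ d) ⟨
    s (d + 0 * r)  ≈⟨ s-digit 0 d<r ⟩
    s 0 + d        ≡⟨ cong (_+ d) s-0 ⟩
    d              ∎

  digitRecursive⇒≈s : ∀ {g} → DigitRecursive g → ∀ n → g n ≈ g 0 + s n
  digitRecursive⇒≈s {g} g-rec = <-rec _ step
    where
    step : ∀ n → (∀ {k} → k < n → g k ≈ g 0 + s k) → g n ≈ g 0 + s n
    step zero    _  = ≡⇒≈ (trans (sym (+-identityʳ (g 0))) (cong (g 0 +_) (sym s-0)))
    step (suc n) ih = begin
      g (suc n)                          ≈⟨ g-rec (suc n) ⟩
      g (suc n / r) + suc n % r          ≈⟨ +-congʳ (suc n % r) (ih (m/n<m (suc n) r 1<r)) ⟩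
      g 0 + s (suc n / r) + suc n % r    ≡⟨ +-assoc (g 0) _ _ ⟩
      g 0 + (s (suc n / r) + suc n % r)  ≈⟨ +-congˡ (g 0) (s-rec (suc n)) ⟨
      g 0 + s (suc n)                    ∎

  s-concat : ∀ K a {k} → k < r ^ K → s (a * r ^ K + k) ≈ s a + s k
  s-concat zero    a (s≤s z≤n) = begin
    s (a * 1 + 0)  ≡⟨ cong s (trans (+-identityʳ (a * 1)) (*-identityʳ a)) ⟩
    s a            ≡⟨ +-identityʳ (s a) ⟨
    s a + 0        ≡⟨ cong (s a +_) s-0 ⟨
    s a + s 0      ∎
  s-concat (suc K) a {k} k<r^1+K = begin
    s (a * r ^ suc K + k)        ≡⟨ cong s split ⟩
    s (d + (a * r ^ K + q) * r)  ≈⟨ s-digit (a * r ^ K + q) d<r ⟩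
    s (a * r ^ K + q) + d        ≈⟨ +-congʳ d (s-concat K a q<r^K) ⟩
    s a + s q + d                ≡⟨ +-assoc (s a) (s q) d ⟩
    s a + (s q + d)              ≈⟨ +-congˡ (s a) (s-digit q d<r) ⟨
    s a + s (d + q * r)          ≡⟨ cong (λ t → s a + s t) k≡ ⟨
    s a + s k                    ∎
    where
    d = k % r
    q = k / r
    d<r : d < r
    d<r = m%n<n k r
    k≡ : k ≡ d + q * r
    k≡ = m≡m%n+[m/n]*n k r
    q<r^K : q < r ^ K
    q<r^K = m<n*o⇒m/o<n (subst (k <_) (*-comm r (r ^ K)) k<r^1+K)
    shift-digits : ∀ a R d q r → a * (r * R) + (d + q * r) ≡ d + (a * R + q) * r
    shift-digits = solve-∀
    split : a * r ^ suc K + k ≡ d + (a * r ^ K + q) * r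
    split = trans (cong (a * r ^ suc K +_) k≡) (shift-digits a (r ^ K) d q r)

  s-suc : ∀ n → ¬ suc n ≈ 0 → s (suc n) ≈ s n + 1
  s-suc n 1+n≉0 with m≤n⇒m<n∨m≡n (m%n<n n r)
  ... | inj₁ 1+d<r = begin
    s (suc n)          ≡⟨ cong (s ∘ suc) n≡ ⟩
    s (suc d + q * r)  ≈⟨ s-digit q 1+d<r ⟩
    s q + suc d        ≡⟨ trans (+-suc (s q) d) (+-comm 1 (s q + d)) ⟩
    s q + d + 1        ≈⟨ +-congʳ 1 (s-digit q (m%n<n n r)) ⟨
    s (d + q * r) + 1  ≡⟨ cong (λ t → s t + 1) n≡ ⟨
    s n + 1            ∎
    where
    d = n % r
    q = n / r
    n≡ : n ≡ d + q * r
    n≡ = m≡m%n+[m/n]*n n r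
  ... | inj₂ 1+d≡r = ⊥-elim (1+n≉0 (≈-trans (≡⇒≈ 1+n≡) (mod-eq (m*n%n≡0 (suc (n / r)) r))))
    where
    1+n≡ : suc n ≡ suc (n / r) * r
    1+n≡ = trans (cong suc (m≡m%n+[m/n]*n n r)) (cong (_+ n / r * r) 1+d≡r)

  increment⇒¬flat : ∀ n → s (suc n) ≈ s n + 1 → ¬ s (suc n) ≈ s n
  increment⇒¬flat n inc flat = 1≉0 (+-cancelˡ (s n) (begin
    s n + 1    ≈⟨ inc ⟨
    s (suc n)  ≈⟨ flat ⟩
    s n        ≡⟨ +-identityʳ (s n) ⟨
    s n + 0    ∎))

  s-not-flat-twice : ∀ q → s (suc q) ≈ s q → s (suc (suc q)) ≈ s (suc q) → ⊥
  s-not-flat-twice q flat₁ flat₂ with suc q % r ≟ 0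
  ... | no  1+q≉0 = increment⇒¬flat q (s-suc q (1+q≉0 ∘ %-eq)) flat₁
  ... | yes 1+q≈0 = increment⇒¬flat (suc q) (s-suc (suc q) 2+q≉0) flat₂
    where
    2+q≉0 : ¬ suc (suc q) ≈ 0
    2+q≉0 2+q≈0 = 1≉0 (≈-trans (+-congˡ 1 (≈-sym (mod-eq 1+q≈0))) 2+q≈0)

  record Shifted (p c n L : ℕ) : Set where
    constructor shifted
    field at : ∀ v → v ≤ L → s (p + (n + v)) ≈ s (n + v) + c

  open Shifted public

  Shifted-≤ : ∀ {p c n L L′} → L ≤ L′ → Shifted p c n L′ → Shifted p c n L
  Shifted-≤ L≤L′ shift = shifted λ v v≤L → at shift v (≤-trans v≤L L≤L′)

  carry-flat : ∀ {p c} u q → ¬ p ≈ 0 → p + u ≡ m + q * r →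
               s (p + u) ≈ s u + c → s (p + suc u) ≈ s (suc u) + c → s (suc q) ≈ s q
  carry-flat {p} {c} u q p≉0 p+u≡ shift₀ shift₁ = begin
    s (suc q)          ≡⟨ +-identityʳ (s (suc q)) ⟨
    s (suc q) + 0      ≈⟨ s-digit (suc q) z<s ⟨
    s (suc q * r)      ≡⟨ cong s p+1+u≡ ⟨
    s (p + suc u)      ≈⟨ shift₁ ⟩
    s (suc u) + c      ≈⟨ +-congʳ c (s-suc u 1+u≉0) ⟩
    s u + 1 + c        ≡⟨ +-rightComm (s u) 1 c ⟩
    s u + c + 1        ≈⟨ +-congʳ 1 shift₀ ⟨
    s (p + u) + 1      ≡⟨ cong (λ t → s t + 1) p+u≡ ⟩
    s (m + q * r) + 1  ≈⟨ +-congʳ 1 (s-digit q ≤-refl) ⟩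
    s q + m + 1        ≡⟨ trans (+-assoc (s q) m 1) (cong (s q +_) (+-comm m 1)) ⟩
    s q + r            ≈⟨ n+r≈n (s q) ⟩
    s q                ∎
    where
    p+1+u≡ : p + suc u ≡ suc q * r
    p+1+u≡ = trans (+-suc p u) (cong suc p+u≡)
    1+u≉0 : ¬ suc u ≈ 0
    1+u≉0 1+u≈0 = p≉0 (begin
      p              ≡⟨ +-identityʳ p ⟨
      p + 0          ≈⟨ +-congˡ p 1+u≈0 ⟨
      p + suc u      ≡⟨ p+1+u≡ ⟩
      suc q * r      ≈⟨ mod-eq (m*n%n≡0 (suc q) r) ⟩
      0              ∎)

  shifted⇒p≈0 : ∀ {p c n} → Shifted p c n (r + r) → p ≈ 0
  shifted⇒p≈0 {p} {c} {n} shift with p % r ≟ 0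
  ... | yes p%r≡0 = mod-eq p%r≡0
  ... | no  p%r≢0 = ⊥-elim (s-not-flat-twice q
          (subst (λ t → s (suc t) ≈ s t) (+-identityʳ q) (carry-flat-at 0 z≤n))
          (subst (λ t → s (suc t) ≈ s t) (+-comm q 1) (carry-flat-at 1 ≤-refl)))
    where
    a = (p + n) % r
    q = (p + n) / r
    shift-suc : ∀ v → suc v ≤ r + r → s (p + suc (n + v)) ≈ s (suc (n + v)) + c
    shift-suc v 1+v≤ = subst (λ t → s (p + t) ≈ s t + c) (+-suc n v) (at shift (suc v) 1+v≤)
    regroup : ∀ p n v k r → p + (n + (v + k * r)) ≡ p + n + v + k * r
    regroup = solve-∀
    carry-flat-at : ∀ k → k ≤ 1 → s (suc (q + k)) ≈ s (q + k)
    carry-flat-at k k≤1 =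
      carry-flat (n + v) (q + k) (p%r≢0 ∘ %-eq) p+n+v≡ (at shift v (≤-trans (n≤1+n v) 1+v≤)) (shift-suc v 1+v≤)
      where
      v = (m ∸ a) + k * r
      1+v≤ : suc v ≤ r + r
      1+v≤ = s≤s (+-mono-≤ (m∸n≤m m a) (≤-trans (*-monoˡ-≤ r k≤1) (≤-reflexive (*-identityˡ r))))
      p+n+v≡ : p + (n + v) ≡ m + (q + k) * r
      p+n+v≡ = trans (regroup p n (m ∸ a) k r) (fill-last-digit (p + n) k)

  shifted-descend : ∀ {P c n L} → Shifted (P * r) c n (r * L) → Shifted P c (n / r) L
  shifted-descend {P} {c} {n} {L} shift = shifted descend-at
    where
    d = n % r
    q = n / r
    d<r : d < r
    d<r = m%n<n n r
    spread : ∀ P d q w r → d + (P + (q + w)) * r ≡ P * r + (d + (q + w) * r)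
    spread = solve-∀
    descend-at : ∀ w → w ≤ L → s (P + (q + w)) ≈ s (q + w) + c
    descend-at w w≤L = +-cancelʳ d (begin
      s (P + (q + w)) + d        ≈⟨ s-digit (P + (q + w)) d<r ⟨
      s (d + (P + (q + w)) * r)  ≡⟨ cong s (trans (spread P d q w r) (cong (P * r +_) (sym (+-*r-digits n w)))) ⟩
      s (P * r + (n + w * r))    ≈⟨ at shift (w * r) (≤-trans (*-monoˡ-≤ r w≤L) (≤-reflexive (*-comm L r))) ⟩
      s (n + w * r) + c          ≡⟨ cong (λ t → s t + c) (+-*r-digits n w) ⟩
      s (d + (q + w) * r) + c    ≈⟨ +-congʳ c (s-digit (q + w) d<r) ⟩
      s (q + w) + d + c          ≡⟨ +-rightComm (s (q + w)) d c ⟩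
      s (q + w) + c + d          ∎)

  window : ℕ → ℕ
  window zero    = r + r
  window (suc K) = r * window K

  r+r≤window : ∀ K → r + r ≤ window K
  r+r≤window zero    = ≤-refl
  r+r≤window (suc K) = ≤-trans (r+r≤window K) (m≤n*m (window K) r)

  shifted⇒r^K∣p : ∀ K {p c n} → Shifted p c n (window K) → r ^ K ∣ p
  shifted⇒r^K∣p zero    {p} _ = 1∣ p
  shifted⇒r^K∣p (suc K) {p} shift with ≈0⇒r∣ (shifted⇒p≈0 (Shifted-≤ (r+r≤window (suc K)) shift))
  ... | divides-refl P with shifted⇒r^K∣p K (shifted-descend {P} shift)
  ... | divides-refl Q = divides Q (trans (*-assoc Q (r ^ K) r) (cong (Q *_) (*-comm (r ^ K) r)))

module Distality (m : ℕ) .{{_ : NonZero m}} (x₁ : Seq m)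
                 (x₁-fixed : IsFixedPoint m x₁) (x₁0≡0 : x₁ 0 ≡ zero) where

  s : ℕ → ℕ
  s = toℕ ∘ x₁

  open DigitSum m s (DigitRecursion.fixedPoint⇒digitRecursive m x₁-fixed) (cong toℕ x₁0≡0)
  open SetoidReasoning ≈-setoid

  fixedPoint≈ : ∀ {x} → IsFixedPoint m x → ∀ n → toℕ (x n) ≈ toℕ (x 0) + s n
  fixedPoint≈ fixed = digitRecursive⇒≈s (fixedPoint⇒digitRecursive fixed)

  fixedPoint∈X : ∀ {x} → IsFixedPoint m x → InOrbitClosure m x₁ x
  fixedPoint∈X {x} fixed N = i * r ^ N , λ k k<N → toℕ-≈⇒≡ (begin
    toℕ (x k)          ≈⟨ fixedPoint≈ fixed k ⟩
    i + s k            ≈⟨ +-congʳ (s k) (s-letter (toℕ<n (x 0))) ⟨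
    s i + s k          ≈⟨ s-concat N i (<-trans k<N (n<r^n N)) ⟨
    s (i * r ^ N + k)  ∎)
    where
    i = toℕ (x 0)

  agreement⇒shifted : ∀ {x y : Seq m} {n p L} → IsFixedPoint m x →
    (∀ v → v ≤ L → x (n + v) ≡ y (n + v)) → (∀ v → v ≤ L → y (n + v) ≡ x₁ (p + (n + v))) →
    Shifted p (toℕ (x 0)) n L
  agreement⇒shifted {x} {y} {n} {p} fixed x≡y y≡x₁ = shifted λ v v≤L → begin
    s (p + (n + v))        ≡⟨ cong toℕ (trans (x≡y v v≤L) (y≡x₁ v v≤L)) ⟨
    toℕ (x (n + v))        ≈⟨ fixedPoint≈ fixed (n + v) ⟩
    toℕ (x 0) + s (n + v)  ≡⟨ +-comm (toℕ (x 0)) (s (n + v)) ⟩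
    s (n + v) + toℕ (x 0)  ∎

  occurrence⇒≈s : ∀ {y : Seq m} t Q → (∀ k → k ≤ t → y k ≡ x₁ (Q * r ^ t + k)) → toℕ (y t) ≈ toℕ (y 0) + s t
  occurrence⇒≈s {y} t Q y≡x₁ = begin
    toℕ (y t)          ≡⟨ cong toℕ (y≡x₁ t ≤-refl) ⟩
    s (Q * r ^ t + t)  ≈⟨ s-concat t Q (n<r^n t) ⟩
    s Q + s t          ≈⟨ +-congʳ (s t) y0≈sQ ⟨
    toℕ (y 0) + s t    ∎
    where
    y0≈sQ : toℕ (y 0) ≈ s Q
    y0≈sQ = begin
      toℕ (y 0)          ≡⟨ cong toℕ (y≡x₁ 0 z≤n) ⟩
      s (Q * r ^ t + 0)  ≈⟨ s-concat t Q (m^n>0 r t) ⟩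
      s Q + s 0          ≡⟨ cong (s Q +_) (cong toℕ x₁0≡0) ⟩
      s Q + 0            ≡⟨ +-identityʳ (s Q) ⟩
      s Q                ∎

  proximal⇒≈s : ∀ {x y : Seq m} → IsFixedPoint m x → InOrbitClosure m x₁ y → Proximal m x y →
                ∀ t → toℕ (y t) ≈ toℕ (y 0) + s t
  proximal⇒≈s {x} {y} fixed y∈X x~y t with x~y (window t) (≤-trans z<s (r+r≤window t))
  ... | n , x≡y with y∈X (suc (t + (n + window t)))
  ... | p , y≡x₁
        with shifted⇒r^K∣p t (agreement⇒shifted {y = y} {p = p} fixed x≡y
               (λ v v≤ → y≡x₁ (n + v) (s≤s (≤-trans (+-monoʳ-≤ n v≤) (m≤n+m (n + window t) t)))))
  ... | divides-refl Q = occurrence⇒≈s {y} t Q (λ k k≤t → y≡x₁ k (s≤s (≤-trans k≤t (m≤m+n t _))))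

  fixedPoint-distal : ∀ {x} → IsFixedPoint m x →
                      ∀ y → InOrbitClosure m x₁ y → Proximal m x y → ∀ k → y k ≡ x k
  fixedPoint-distal {x} fixed y y∈X x~y k = toℕ-≈⇒≡ (begin
    toℕ (y k)        ≈⟨ y≈ k ⟩
    toℕ (y 0) + s k  ≈⟨ +-congʳ (s k) y0≈x0 ⟩
    toℕ (x 0) + s k  ≈⟨ fixedPoint≈ fixed k ⟨
    toℕ (x k)        ∎)
    where
    y≈ : ∀ t → toℕ (y t) ≈ toℕ (y 0) + s t
    y≈ = proximal⇒≈s fixed y∈X x~y
    y0≈x0 : toℕ (y 0) ≈ toℕ (x 0)
    y0≈x0 with x~y 1 z<s
    ... | n , x≡y = +-cancelʳ (s n) (begin
      toℕ (y 0) + s n  ≈⟨ y≈ n ⟨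
      toℕ (y n)        ≡⟨ cong (toℕ ∘ y) (+-identityʳ n) ⟨
      toℕ (y (n + 0))  ≡⟨ cong toℕ (x≡y 0 z≤n) ⟨
      toℕ (x (n + 0))  ≡⟨ cong (toℕ ∘ x) (+-identityʳ n) ⟩
      toℕ (x n)        ≈⟨ fixedPoint≈ fixed n ⟩
      toℕ (x 0) + s n  ∎)

lemma6p1 : (m : ℕ) (x₁ : Seq m) → IsFixedPoint m x₁ → x₁ 0 ≡ zero →
    (i : Fin (suc m)) (x : Seq m) → IsFixedPoint m x → x 0 ≡ i →
    Distal m (InOrbitClosure m x₁) x
lemma6p1 zero x₁ _ _ _ x _ _ = (λ _ → 0 , λ _ _ → Fin1-unique _ _) , λ _ _ _ _ → Fin1-unique _ _
  where
  Fin1-unique : (a b : Fin 1) → a ≡ b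
  Fin1-unique zero zero = refl
lemma6p1 m@(suc _) x₁ x₁-fixed x₁0≡0 _ x fixed _ = fixedPoint∈X fixed , fixedPoint-distal fixed
  where open Distality m x₁ x₁-fixed x₁0≡0
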